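{- For every $n \in \mathbb{N}$, $r(2,\mathbb{F}_3^n)\cdot\bigl(r(2,\mathbb{F}_3^n)-1\bigr) \le 3^n - 1$.
   Context: $\mathbb{F}_3^n$ denotes $n$-dimensional affine space over the field with three elements. A subset $C \subseteq \mathbb{F}_3^n$ is a $2$-cap if no three points of $C$ lie on a $1$-dimensional affine subspace and no four points of $C$ lie on a $2$-dimensional affine subspace (equivalently, every subset of $C$ of size at most $4$ is affinely independent). $r(2,\mathbb{F}_3^n)$ denotes the largest cardinality of a $2$-cap in $\mathbb{F}_3^n$. -}

module Defs where

open import Data.Nat using (ℕ; zero; suc; _+_; _*_; _≤_)
open import Data.Nat.DivMod using (_mod_)
open import Data.Fin using (Fin; toℕ)
open import Data.List using (List)
open import Data.Vec using (Vec; lookup)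
open import Data.List.Membership.Propositional using (_∈_)
open import Data.List.Relation.Unary.Unique.Propositional using (Unique)
open import Data.Product using (_×_)
open import Function.Definitions using (Injective)
open import Relation.Binary.PropositionalEquality using (_≡_)

F3 : Set
F3 = Fin 3

_+₃_ : F3 → F3 → F3
a +₃ b = (toℕ a + toℕ b) mod 3

_*₃_ : F3 → F3 → F3
a *₃ b = (toℕ a * toℕ b) mod 3

0₃ : F3
0₃ = Fin.zero

sum₃ : ∀ {k} → (Fin k → F3) → F3
sum₃ {zero}  f = 0₃
sum₃ {suc k} f = f Fin.zero +₃ sum₃ (λ i → f (Fin.suc i))

Point : ℕ → Set
Point n = Vec F3 n

AffinelyIndependent : ∀ {n k} → (Fin k → Point n) → Set
AffinelyIndependent {n} {k} p =
  (c : Fin k → F3) →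
  sum₃ c ≡ 0₃ →
  ((j : Fin n) → sum₃ (λ i → c i *₃ lookup (p i) j) ≡ 0₃) →
  (i : Fin k) → c i ≡ 0₃

Is2Cap : ∀ {n} → List (Point n) → Set
Is2Cap {n} C =
  Unique C ×
  ((k : ℕ) → k ≤ 4 → (p : Fin k → Point n) → Injective _≡_ _≡_ p →
     ((i : Fin k) → p i ∈ C) → AffinelyIndependent p)

-- Map each ordered pair (a, b) of distinct points of a 2-cap C to its difference a − b.
-- If a − b = c − d for two different such pairs, then either two of the points coincide
-- (impossible: a − b = a − d forces b = d, and a − b = b − a forces a = b in characteristic 3),
-- or three distinct points satisfy a − b = b − c, i.e. lie on a line, or four distinct points
-- satisfy a − b − c + d = 0, i.e. lie on a plane.  So the |C|(|C| − 1) differences are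
-- distinct nonzero vectors of 𝔽₃ⁿ, of which there are 3ⁿ − 1.
module Submission where

open import Defs
open import Data.Nat using (ℕ; suc; _*_; _∸_; _^_; _≤_)
open import Data.Nat.Properties using (≤-refl; n≤1+n)
open import Data.Fin using (Fin; zero; suc; _≟_; combine; remQuot; punchIn; punchOut)
open import Data.Fin.Properties
  using (all?; combine-injective; combine-remQuot; punchIn-injective; punchInᵢ≢i; punchOut-injective; injective⇒≤)
open import Data.Vec using (Vec; []; _∷_; lookup; zipWith; replicate)
open import Data.Vec.Properties using (lookup-zipWith; lookup-replicate; tabulate∘lookup; tabulate-cong)
import Data.Vec.Properties as Vec using (≡-dec)
open import Data.List using (List; length; []; _∷_)
import Data.List as List using (lookup)
open import Data.List.Membership.Propositional using (_∈_)
open import Data.List.Membership.Propositional.Properties using (∈-lookup)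
open import Data.List.Relation.Unary.All using (All; []; _∷_)
import Data.List.Relation.Unary.All as All using (lookup)
open import Data.List.Relation.Unary.AllPairs using ([]; _∷_)
open import Data.List.Relation.Unary.Unique.Propositional using (Unique)
open import Data.Product using (_×_; _,_; proj₁; proj₂; uncurry)
open import Data.Product.Properties using (,-injectiveˡ; ,-injectiveʳ)
open import Data.Empty using (⊥-elim)
open import Function using (_∘_)
open import Function.Definitions using (Injective)
open import Relation.Nullary using (Dec; yes; no)
open import Relation.Nullary.Decidable using (from-yes; _→-dec_)
open import Relation.Binary.PropositionalEquality
  using (_≡_; _≢_; ≢-sym; refl; sym; trans; cong; cong₂; module ≡-Reasoning)

one two : F3
one = suc zero
two = suc (suc zero)

_−₃_ : F3 → F3 → F3
x −₃ y = x +₃ (two *₃ y)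

combination : ∀ {k} → Vec F3 k → Vec F3 k → F3
combination c x = sum₃ (λ i → lookup c i *₃ lookup x i)

one≢0₃ : one ≢ 0₃
one≢0₃ ()

−₃-cancelˡ : ∀ x y z → x −₃ y ≡ x −₃ z → y ≡ z
−₃-cancelˡ = from-yes (all? λ x → all? λ y → all? λ z → (x −₃ y ≟ x −₃ z) →-dec (y ≟ z))

−₃-cancelʳ : ∀ x y z → x −₃ z ≡ y −₃ z → x ≡ y
−₃-cancelʳ = from-yes (all? λ x → all? λ y → all? λ z → (x −₃ z ≟ y −₃ z) →-dec (x ≟ y))

−₃-swap⇒≡ : ∀ x y → x −₃ y ≡ y −₃ x → x ≡ y
−₃-swap⇒≡ = from-yes (all? λ x → all? λ y → (x −₃ y ≟ y −₃ x) →-dec (x ≟ y))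

−₃≡0⇒≡ : ∀ x y → x −₃ y ≡ 0₃ → x ≡ y
−₃≡0⇒≡ = from-yes (all? λ x → all? λ y → (x −₃ y ≟ 0₃) →-dec (x ≟ y))

midpoint-relation : ∀ x y z → x −₃ y ≡ y −₃ z →
  combination (one ∷ one ∷ one ∷ []) (x ∷ y ∷ z ∷ []) ≡ 0₃
midpoint-relation = from-yes (all? λ x → all? λ y → all? λ z →
  (x −₃ y ≟ y −₃ z) →-dec (combination (one ∷ one ∷ one ∷ []) (x ∷ y ∷ z ∷ []) ≟ 0₃))

parallelogram-relation : ∀ x y z w → x −₃ y ≡ z −₃ w →
  combination (one ∷ two ∷ two ∷ one ∷ []) (x ∷ y ∷ z ∷ w ∷ []) ≡ 0₃
parallelogram-relation = from-yes (all? λ x → all? λ y → all? λ z → all? λ w →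
  (x −₃ y ≟ z −₃ w) →-dec (combination (one ∷ two ∷ two ∷ one ∷ []) (x ∷ y ∷ z ∷ w ∷ []) ≟ 0₃))

module _ {n : ℕ} where

  _−ᵥ_ : Point n → Point n → Point n
  _−ᵥ_ = zipWith _−₃_

  _≟ᵥ_ : (u v : Point n) → Dec (u ≡ v)
  _≟ᵥ_ = Vec.≡-dec _≟_

  lookup-extensional : {u v : Point n} → (∀ j → lookup u j ≡ lookup v j) → u ≡ v
  lookup-extensional {u} {v} u≗v =
    trans (sym (tabulate∘lookup u)) (trans (tabulate-cong u≗v) (tabulate∘lookup v))

  coordinates : {u v w x : Point n} → u −ᵥ v ≡ w −ᵥ x →
    ∀ j → lookup u j −₃ lookup v j ≡ lookup w j −₃ lookup x j
  coordinates {u} {v} {w} {x} eq j = begin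
    lookup u j −₃ lookup v j  ≡⟨ lookup-zipWith _−₃_ j u v ⟨
    lookup (u −ᵥ v) j         ≡⟨ cong (λ p → lookup p j) eq ⟩
    lookup (w −ᵥ x) j         ≡⟨ lookup-zipWith _−₃_ j w x ⟩
    lookup w j −₃ lookup x j  ∎
    where open ≡-Reasoning

  −ᵥ-cancelˡ : {u v w : Point n} → u −ᵥ v ≡ u −ᵥ w → v ≡ w
  −ᵥ-cancelˡ {u} {v} {w} eq =
    lookup-extensional λ j → −₃-cancelˡ (lookup u j) (lookup v j) (lookup w j) (coordinates eq j)

  −ᵥ-cancelʳ : {u v w : Point n} → u −ᵥ w ≡ v −ᵥ w → u ≡ v
  −ᵥ-cancelʳ {u} {v} {w} eq =
    lookup-extensional λ j → −₃-cancelʳ (lookup u j) (lookup v j) (lookup w j) (coordinates eq j)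

  −ᵥ-swap⇒≡ : {u v : Point n} → u −ᵥ v ≡ v −ᵥ u → u ≡ v
  −ᵥ-swap⇒≡ {u} {v} eq = lookup-extensional λ j → −₃-swap⇒≡ (lookup u j) (lookup v j) (coordinates eq j)

  −ᵥ≡0⇒≡ : {u v : Point n} → u −ᵥ v ≡ replicate n 0₃ → u ≡ v
  −ᵥ≡0⇒≡ {u} {v} eq = lookup-extensional λ j → −₃≡0⇒≡ (lookup u j) (lookup v j) (begin
    lookup u j −₃ lookup v j       ≡⟨ lookup-zipWith _−₃_ j u v ⟨
    lookup (u −ᵥ v) j              ≡⟨ cong (λ p → lookup p j) eq ⟩
    lookup (replicate n 0₃) j      ≡⟨ lookup-replicate j 0₃ ⟩
    0₃                             ∎)
    where open ≡-Reasoning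

lookup-injective : ∀ {A : Set} {xs : List A} → Unique xs → Injective _≡_ _≡_ (List.lookup xs)
lookup-injective {xs = _ ∷ _} _          {zero} {zero} _ = refl
lookup-injective {xs = _ ∷ _} (x∉xs ∷ _) {zero} {suc j} eq = ⊥-elim (All.lookup x∉xs (∈-lookup j) eq)
lookup-injective {xs = _ ∷ _} (x∉xs ∷ _) {suc i} {zero} eq = ⊥-elim (All.lookup x∉xs (∈-lookup i) (sym eq))
lookup-injective {xs = _ ∷ _} (_ ∷ unique) {suc i} {suc j} eq = cong suc (lookup-injective unique eq)

encode : ∀ {m n} → Vec (Fin m) n → Fin (m ^ n)
encode []      = zero
encode (x ∷ v) = combine x (encode v)

encode-injective : ∀ {m n} → Injective _≡_ _≡_ (encode {m} {n})
encode-injective {x = []}    {[]}    _  = refl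
encode-injective {x = x ∷ u} {y ∷ v} eq with refl , eq′ ← combine-injective x (encode u) y (encode v) eq =
  cong (x ∷_) (encode-injective eq′)

injective-avoiding⇒≤∸1 : ∀ {m N} {f : Fin m → Fin N} → Injective _≡_ _≡_ f →
  (y : Fin N) → (∀ i → f i ≢ y) → m ≤ N ∸ 1
injective-avoiding⇒≤∸1 {N = suc _} {f} f-injective y f≢y =
  injective⇒≤ {f = λ i → punchOut (y≢f i)} (λ eq → f-injective (punchOut-injective (y≢f _) (y≢f _) eq))
  where
  y≢f : ∀ i → y ≢ f i
  y≢f i = ≢-sym (f≢y i)

punchInPair : ∀ {L} → Fin (suc L) × Fin L → Fin (suc L) × Fin (suc L)
punchInPair (i , x) = i , punchIn i x

punchInPair-distinct : ∀ {L} (p : Fin (suc L) × Fin L) →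
  proj₁ (punchInPair p) ≢ proj₂ (punchInPair p)
punchInPair-distinct (i , x) = ≢-sym (punchInᵢ≢i i x)

punchInPair-injective : ∀ {L} → Injective _≡_ _≡_ (punchInPair {L})
punchInPair-injective {x = i , x} {j , y} eq with refl ← ,-injectiveˡ eq =
  cong (i ,_) (punchIn-injective i x y (,-injectiveʳ eq))

remQuot-injective : ∀ {L} M → Injective _≡_ _≡_ (remQuot {L} M)
remQuot-injective {L} M {k} {k′} eq = begin
  k                                    ≡⟨ combine-remQuot {L} M k ⟨
  uncurry combine (remQuot {L} M k)    ≡⟨ cong (uncurry combine) eq ⟩
  uncurry combine (remQuot {L} M k′)   ≡⟨ combine-remQuot {L} M k′ ⟩
  k′                                   ∎
  where open ≡-Reasoning

distinctPair : ∀ {L} → Fin (L * (L ∸ 1)) → Fin L × Fin L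
distinctPair {suc L} = punchInPair ∘ remQuot L

distinctPair-distinct : ∀ {L} (k : Fin (L * (L ∸ 1))) →
  proj₁ (distinctPair {L} k) ≢ proj₂ (distinctPair {L} k)
distinctPair-distinct {suc L} k = punchInPair-distinct (remQuot L k)

distinctPair-injective : ∀ {L} → Injective _≡_ _≡_ (distinctPair {L})
distinctPair-injective {suc L} = remQuot-injective L ∘ punchInPair-injective

module _ {n : ℕ} {C : List (Point n)} (cap : Is2Cap C) where

  sublist-independent : (xs : List (Point n)) → length xs ≤ 4 → Unique xs → All (_∈ C) xs →
    AffinelyIndependent (List.lookup xs)
  sublist-independent xs small unique xs⊆C =
    proj₂ cap (length xs) small (List.lookup xs) (lookup-injective unique)
      (λ i → All.lookup xs⊆C (∈-lookup i))

  no-midpoint : {a b c : Point n} → a ∈ C → b ∈ C → c ∈ C → a ≢ b → a ≢ c → b ≢ c →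
    a −ᵥ b ≢ b −ᵥ c
  no-midpoint {a} {b} {c} a∈C b∈C c∈C a≢b a≢c b≢c eq = one≢0₃ (independent
    (lookup (one ∷ one ∷ one ∷ [])) refl
    (λ j → midpoint-relation (lookup a j) (lookup b j) (lookup c j) (coordinates eq j)) zero)
    where
    independent : AffinelyIndependent (List.lookup (a ∷ b ∷ c ∷ []))
    independent = sublist-independent (a ∷ b ∷ c ∷ []) (n≤1+n 3)
      ((a≢b ∷ a≢c ∷ []) ∷ (b≢c ∷ []) ∷ [] ∷ []) (a∈C ∷ b∈C ∷ c∈C ∷ [])

  no-parallelogram : {a b c d : Point n} → a ∈ C → b ∈ C → c ∈ C → d ∈ C →
    a ≢ b → a ≢ c → a ≢ d → b ≢ c → b ≢ d → c ≢ d → a −ᵥ b ≢ c −ᵥ d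
  no-parallelogram {a} {b} {c} {d} a∈C b∈C c∈C d∈C a≢b a≢c a≢d b≢c b≢d c≢d eq = one≢0₃ (independent
    (lookup (one ∷ two ∷ two ∷ one ∷ [])) refl
    (λ j → parallelogram-relation (lookup a j) (lookup b j) (lookup c j) (lookup d j) (coordinates eq j)) zero)
    where
    independent : AffinelyIndependent (List.lookup (a ∷ b ∷ c ∷ d ∷ []))
    independent = sublist-independent (a ∷ b ∷ c ∷ d ∷ []) ≤-refl
      ((a≢b ∷ a≢c ∷ a≢d ∷ []) ∷ (b≢c ∷ b≢d ∷ []) ∷ (c≢d ∷ []) ∷ [] ∷ []) (a∈C ∷ b∈C ∷ c∈C ∷ d∈C ∷ [])

  differences-injective : {a b c d : Point n} → a ∈ C → b ∈ C → c ∈ C → d ∈ C → a ≢ b → c ≢ d →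
    a −ᵥ b ≡ c −ᵥ d → a ≡ c × b ≡ d
  differences-injective {a} {b} {c} {d} a∈C b∈C c∈C d∈C a≢b c≢d eq
    with a ≟ᵥ c | b ≟ᵥ d
  ... | yes a≡c  | yes b≡d = a≡c , b≡d
  ... | yes refl | no b≢d  = ⊥-elim (b≢d (−ᵥ-cancelˡ eq))
  ... | no a≢c   | yes refl = ⊥-elim (a≢c (−ᵥ-cancelʳ eq))
  ... | no a≢c   | no b≢d with a ≟ᵥ d | b ≟ᵥ c
  ...   | yes refl | yes refl = ⊥-elim (a≢b (−ᵥ-swap⇒≡ eq))
  ...   | yes refl | no b≢c  = ⊥-elim (no-midpoint c∈C a∈C b∈C (≢-sym a≢c) (≢-sym b≢c) a≢b (sym eq))
  ...   | no a≢d   | yes refl = ⊥-elim (no-midpoint a∈C b∈C d∈C a≢b a≢d b≢d eq)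
  ...   | no a≢d   | no b≢c  = ⊥-elim (no-parallelogram a∈C b∈C c∈C d∈C a≢b a≢c a≢d b≢c b≢d c≢d eq)

  distinctPoints : (k : Fin (length C * (length C ∸ 1))) →
    List.lookup C (proj₁ (distinctPair k)) ≢ List.lookup C (proj₂ (distinctPair k))
  distinctPoints k = distinctPair-distinct k ∘ lookup-injective (proj₁ cap)

  pairDifference : Fin (length C * (length C ∸ 1)) → Point n
  pairDifference k = List.lookup C (proj₁ (distinctPair k)) −ᵥ List.lookup C (proj₂ (distinctPair k))

  pairDifference-nonzero : ∀ k → pairDifference k ≢ replicate n 0₃
  pairDifference-nonzero k = distinctPoints k ∘ −ᵥ≡0⇒≡

  pairDifference-injective : Injective _≡_ _≡_ pairDifference
  pairDifference-injective {k} {k′} eq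
    with a≡c , b≡d ← differences-injective
           (∈-lookup (proj₁ (distinctPair k))) (∈-lookup (proj₂ (distinctPair k)))
           (∈-lookup (proj₁ (distinctPair k′))) (∈-lookup (proj₂ (distinctPair k′)))
           (distinctPoints k) (distinctPoints k′) eq
    = distinctPair-injective
        (cong₂ _,_ (lookup-injective (proj₁ cap) a≡c) (lookup-injective (proj₁ cap) b≡d))

proposition3p3 : (n : ℕ) (C : List (Point n)) → Is2Cap C →
    length C * (length C ∸ 1) ≤ 3 ^ n ∸ 1
proposition3p3 n C cap =
  injective-avoiding⇒≤∸1 {f = encode ∘ pairDifference cap}
    (pairDifference-injective cap ∘ encode-injective)
    (encode (replicate n 0₃))
    (λ k → pairDifference-nonzero cap k ∘ encode-injective)
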